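{- For a connected graph $G$: (1) $\lambda(M(G))=4$ if and only if $G\cong K_2$; (2) $\lambda(M(G))=6$ if and only if $G\in\{P_3,P_4,C_3\}$; (3) $\lambda(M(G))=7$ if and only if $G\in\{P_5,P_6,C_6\}$.
   Context: $P_n$ denotes the path and $C_n$ the cycle on $n$ vertices. An $L(2,1)$-labeling of $G$ is a map $f:V\to\{0,1,2,\dots\}$ with $|f(x)-f(y)|\ge 2$ if $d_G(x,y)=1$ and $|f(x)-f(y)|\ge1$ if $d_G(x,y)=2$; $\lambda(G)$ is the minimum over such $f$ of the largest label. For $V=\{v_1,\dots,v_n\}$, $M(G)$ has vertex set $V\cup\{v_1',\dots,v_n'\}\cup\{u\}$ and edge set $E\cup\{v_iv_j' : v_iv_j\in E\}\cup\{v_i'u: 1\le i\le n\}$. -}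

module Defs where

open import Data.Nat using (ℕ; zero; suc; _+_; _≤_; _<_; _≥_; ∣_-_∣; _≡ᵇ_)
open import Data.Nat.Properties using (∣n-n∣≡0; ∣-∣-comm)
open import Data.Bool using (Bool; true; false; _∨_)
open import Data.Fin using (Fin; toℕ; splitAt)
open import Data.Sum using (_⊎_; inj₁; inj₂)
open import Data.Product using (Σ; Σ-syntax; _×_; _,_)
open import Function.Bundles using (_↔_; Inverse)
open import Relation.Binary.PropositionalEquality using (_≡_; _≢_; refl; cong)
open import Relation.Nullary using (¬_)

record Graph (n : ℕ) : Set where
  field
    adj    : Fin n → Fin n → Bool
    sym    : ∀ i j → adj i j ≡ adj j i
    irrefl : ∀ i → adj i i ≡ false
open Graph public

_~[_]_ : {n : ℕ} → Fin n → Graph n → Fin n → Set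
i ~[ G ] j = adj G i j ≡ true

data Reach {n : ℕ} (G : Graph n) : Fin n → Fin n → Set where
  here : ∀ {i} → Reach G i i
  step : ∀ {i j k} → i ~[ G ] j → Reach G j k → Reach G i k

Connected : {n : ℕ} → Graph n → Set
Connected {n} G = ∀ (i j : Fin n) → Reach G i j

Dist2 : {n : ℕ} → Graph n → Fin n → Fin n → Set
Dist2 {n} G x y = x ≢ y × ¬ (x ~[ G ] y) × Σ[ w ∈ Fin n ] (x ~[ G ] w × w ~[ G ] y)

IsL21 : {n : ℕ} → Graph n → (Fin n → ℕ) → Set
IsL21 {n} G f =
  (∀ (x y : Fin n) → x ~[ G ] y → 2 ≤ ∣ f x - f y ∣) ×
  (∀ (x y : Fin n) → Dist2 G x y → 1 ≤ ∣ f x - f y ∣)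

HasL21Span : {n : ℕ} → Graph n → ℕ → Set
HasL21Span {n} G k = Σ[ f ∈ (Fin n → ℕ) ] (IsL21 G f × (∀ v → f v ≤ k))

LambdaIs : {n : ℕ} → Graph n → ℕ → Set
LambdaIs G k = HasL21Span G k × (∀ j → j < k → ¬ HasL21Span G j)

_≅_ : {n m : ℕ} → Graph n → Graph m → Set
_≅_ {n} {m} G H =
  Σ[ φ ∈ (Fin n ↔ Fin m) ] (∀ i j → adj H (Inverse.to φ i) (Inverse.to φ j) ≡ adj G i j)

Path : (m : ℕ) → Graph m
Path m = record
  { adj    = λ i j → ∣ toℕ i - toℕ j ∣ ≡ᵇ 1
  ; sym    = λ i j → cong (_≡ᵇ 1) (∣-∣-comm (toℕ i) (toℕ j))
  ; irrefl = λ i → cong (_≡ᵇ 1) (∣n-n∣≡0 (toℕ i))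
  }

-- Cycle C_m for m = k + 3 on vertices 0,…,m-1: i ~ j iff |i - j| ∈ {1, m-1}.
Cycle : (k : ℕ) → Graph (suc (suc (suc k)))
Cycle k = record
  { adj    = λ i j → (∣ toℕ i - toℕ j ∣ ≡ᵇ 1) ∨ (∣ toℕ i - toℕ j ∣ ≡ᵇ suc (suc k))
  ; sym    = λ i j → cong (λ d → (d ≡ᵇ 1) ∨ (d ≡ᵇ suc (suc k))) (∣-∣-comm (toℕ i) (toℕ j))
  ; irrefl = λ i → cong (λ d → (d ≡ᵇ 1) ∨ (d ≡ᵇ suc (suc k))) (∣n-n∣≡0 (toℕ i))
  }

K₂ : Graph 2
K₂ = Path 2

P₃ P₄ P₅ P₆ : Graph _
P₃ = Path 3
P₄ = Path 4
P₅ = Path 5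
P₆ = Path 6

C₃ : Graph 3
C₃ = Cycle 0

C₆ : Graph 6
C₆ = Cycle 3

-- Mycielskian M(G) on Fin (n + n + 1): the first n vertices are v_1..v_n,
-- the next n are v_1'..v_n', and the last one is u.
data MKind (n : ℕ) : Set where
  orig   : Fin n → MKind n
  shadow : Fin n → MKind n
  hub    : MKind n

kind : {n : ℕ} → Fin (n + n + 1) → MKind n
kind {n} x with splitAt (n + n) x
... | inj₂ _ = hub
... | inj₁ y with splitAt n y
...   | inj₁ i = orig i
...   | inj₂ i = shadow i

madj : {n : ℕ} → Graph n → MKind n → MKind n → Bool
madj G (orig i)   (orig j)   = adj G i j
madj G (orig i)   (shadow j) = adj G i j
madj G (shadow i) (orig j)   = adj G i j
madj G (shadow i) (shadow j) = false
madj G (shadow i) hub        = true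
madj G hub        (shadow j) = true
madj G (orig i)   hub        = false
madj G hub        (orig j)   = false
madj G hub        hub        = false

madj-sym : {n : ℕ} (G : Graph n) → ∀ a b → madj G a b ≡ madj G b a
madj-sym G (orig i)   (orig j)   = sym G i j
madj-sym G (orig i)   (shadow j) = sym G i j
madj-sym G (shadow i) (orig j)   = sym G i j
madj-sym G (shadow i) (shadow j) = refl
madj-sym G (shadow i) hub        = refl
madj-sym G hub        (shadow j) = refl
madj-sym G (orig i)   hub        = refl
madj-sym G hub        (orig j)   = refl
madj-sym G hub        hub        = refl

madj-irrefl : {n : ℕ} (G : Graph n) → ∀ a → madj G a a ≡ false
madj-irrefl G (orig i)   = irrefl G i
madj-irrefl G (shadow i) = refl
madj-irrefl G hub        = refl

M : {n : ℕ} → Graph n → Graph (n + n + 1)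
M G = record
  { adj    = λ x y → madj G (kind x) (kind y)
  ; sym    = λ x y → madj-sym G (kind x) (kind y)
  ; irrefl = λ x → madj-irrefl G (kind x)
  }

module Submission where

-- Both λ and the Mycielskian are monotone under subgraph embeddings. The hub u of M(G) is
-- adjacent to all n shadows, so K_{1,n} ⊆ M(G), and λ(K_{1,7}) = 8; a vertex of degree 3 in G
-- gives M(K_{1,3}) ⊆ M(G), and λ(M(K_{1,3})) = 8. Hence λ(M(G)) ≤ 7 forces a connected G to
-- have at most six vertices and maximum degree at most 2, i.e. to be a path or a cycle on at most
-- six vertices. These finitely many facts are decided by evaluation: an exhaustive enumeration of
-- graphs on at most six vertices, explicit labellings for the upper bounds, and a complete
-- backtracking search for the lower bounds.

open import Data.Bool as Bool using (Bool; true; false; not; _∧_; _∨_; if_then_else_)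
open import Data.Bool.Properties using (∧-conicalˡ; ∧-conicalʳ; ¬-not; T-≡)
open import Data.Empty using (⊥; ⊥-elim)
open import Data.Fin as Fin using (Fin; zero; suc; splitAt; join; _↑ˡ_; _↑ʳ_; inject≤)
open import Data.Fin.Properties
  using (splitAt-↑ˡ; splitAt-↑ʳ; join-splitAt; inject≤-injective; suc-injective)
open import Data.List using (List; []; _∷_; _++_; map; allFin)
open import Data.Maybe as Maybe using (Maybe; just; nothing; fromMaybe)
open import Data.Nat using (ℕ; zero; suc; _+_; _≤_; ∣_-_∣; _≤ᵇ_; _≤?_; z≤n; s≤s)
open import Data.Nat.Properties
  using (≤ᵇ⇒≤; ≤⇒≤ᵇ; ≤-trans; <-cmp; m≤n⇒m<n∨m≡n; m<1+n⇒m≤n; ≰⇒>)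
open import Data.Product using (Σ-syntax; _×_; _,_; proj₁)
open import Data.Sum using (_⊎_; inj₁; inj₂)
open import Data.Unit using (⊤; tt)
open import Data.Vec using (Vec; []; _∷_; lookup; tabulate)
open import Data.Vec.Properties using (lookup∘tabulate)
open import Function using (_∘_; id)
open import Function.Bundles using (_⇔_; Inverse; Injection; Equivalence; mk⇔; mk↔ₛ′)
open import Function.Construct.Composition using (_↔-∘_)
open import Function.Construct.Identity using (↔-id)
open import Function.Construct.Symmetry using (↔-sym)
open import Function.Definitions using (Injective)
open import Function.Properties.Inverse using (↔⇒↣)
open import Relation.Binary using (tri<; tri≈; tri>)
open import Relation.Binary.PropositionalEquality
  using (_≡_; _≢_; refl; cong; cong₂; subst; subst₂; trans) renaming (sym to ≡-sym)
open import Relation.Nullary using (¬_; Dec; yes; no)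
open import Relation.Nullary.Decidable using (⌊_⌋)

open import Defs

≡false⇒≢true : ∀ {b} → b ≡ false → b ≢ true
≡false⇒≢true refl ()

not-≡true : ∀ {b} → not b ≡ true → b ≡ false
not-≡true {false} _ = refl

∨-true : ∀ {a b} → a ∨ b ≡ true → a ≡ true ⊎ b ≡ true
∨-true {true}  _ = inj₁ refl
∨-true {false} h = inj₂ h

∨-trueˡ : ∀ {a} b → a ≡ true → a ∨ b ≡ true
∨-trueˡ b refl = refl

∨-trueʳ : ∀ a {b} → b ≡ true → a ∨ b ≡ true
∨-trueʳ true  _ = refl
∨-trueʳ false h = h

∧-true : ∀ {a b} → a ≡ true → b ≡ true → a ∧ b ≡ true
∧-true refl refl = refl

≤ᵇ-sound : ∀ {m n} → (m ≤ᵇ n) ≡ true → m ≤ n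
≤ᵇ-sound {m} {n} h = ≤ᵇ⇒≤ m n (Equivalence.from T-≡ h)

≤ᵇ-complete : ∀ {m n} → m ≤ n → (m ≤ᵇ n) ≡ true
≤ᵇ-complete m≤n = Equivalence.to T-≡ (≤⇒≤ᵇ m≤n)

isYes-sound : ∀ {A : Set} (a? : Dec A) → ⌊ a? ⌋ ≡ true → A
isYes-sound (yes a) _ = a

isNo-sound : ∀ {A : Set} (a? : Dec A) → not ⌊ a? ⌋ ≡ true → ¬ A
isNo-sound (no ¬a) _ = ¬a

isNo-complete : ∀ {A : Set} (a? : Dec A) → ¬ A → not ⌊ a? ⌋ ≡ true
isNo-complete (yes a) ¬a = ⊥-elim (¬a a)
isNo-complete (no _)  _  = refl

anyᶠ : ∀ {n} → (Fin n → Bool) → Bool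
anyᶠ {zero}  p = false
anyᶠ {suc n} p = p zero ∨ anyᶠ (p ∘ suc)

allᶠ : ∀ {n} → (Fin n → Bool) → Bool
allᶠ {zero}  p = true
allᶠ {suc n} p = p zero ∧ allᶠ (p ∘ suc)

anyᶠ-sound : ∀ {n} (p : Fin n → Bool) → anyᶠ p ≡ true → Σ[ i ∈ Fin n ] p i ≡ true
anyᶠ-sound {suc n} p h with ∨-true {p zero} h
... | inj₁ p0 = zero , p0
... | inj₂ rest with anyᶠ-sound (p ∘ suc) rest
...   | i , pi = suc i , pi

anyᶠ-complete : ∀ {n} (p : Fin n → Bool) i → p i ≡ true → anyᶠ p ≡ true
anyᶠ-complete {suc n} p zero    pi = ∨-trueˡ _ pi
anyᶠ-complete {suc n} p (suc i) pi = ∨-trueʳ (p zero) (anyᶠ-complete (p ∘ suc) i pi)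

allᶠ-sound : ∀ {n} (p : Fin n → Bool) → allᶠ p ≡ true → ∀ i → p i ≡ true
allᶠ-sound {suc n} p h zero    = ∧-conicalˡ _ _ h
allᶠ-sound {suc n} p h (suc i) = allᶠ-sound (p ∘ suc) (∧-conicalʳ (p zero) _ h) i

module _ {n : ℕ} (G : Graph n) where

  distance2ᵇ : Fin n → Fin n → Bool
  distance2ᵇ v w = not ⌊ v Fin.≟ w ⌋ ∧ anyᶠ (λ u → adj G v u ∧ adj G u w)

  separation : Fin n → Fin n → ℕ
  separation v w = if adj G v w then 2 else if distance2ᵇ v w then 1 else 0

  distance2ᵇ-sound : ∀ {v w} → distance2ᵇ v w ≡ true → ¬ (v ~[ G ] w) → Dist2 G v w
  distance2ᵇ-sound {v} {w} h v≁w with anyᶠ-sound (λ u → adj G v u ∧ adj G u w) (∧-conicalʳ _ _ h)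
  ... | u , v~u~w =
      isNo-sound (v Fin.≟ w) (∧-conicalˡ _ _ h) , v≁w , u
    , ∧-conicalˡ _ _ v~u~w , ∧-conicalʳ (adj G v u) _ v~u~w

  distance2ᵇ-complete : ∀ {v w} → Dist2 G v w → distance2ᵇ v w ≡ true
  distance2ᵇ-complete {v} {w} (v≢w , _ , u , v~u , u~w) =
    ∧-true (isNo-complete (v Fin.≟ w) v≢w)
           (anyᶠ-complete (λ u → adj G v u ∧ adj G u w) u (∧-true v~u u~w))

  separation-adjacent : ∀ {v w} → v ~[ G ] w → separation v w ≡ 2
  separation-adjacent v~w rewrite v~w = refl

  separation-distance2 : ∀ {v w} → Dist2 G v w → separation v w ≡ 1
  separation-distance2 d@(_ , v≁w , _) rewrite ¬-not v≁w | distance2ᵇ-complete d = refl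

  IsL21⇒separated : ∀ f → IsL21 G f → ∀ v w → separation v w ≤ ∣ f v - f w ∣
  IsL21⇒separated f (adjacent , distance2) v w with adj G v w in v~w
  ... | true = adjacent v w v~w
  ... | false with distance2ᵇ v w in d2
  ...   | false = z≤n
  ...   | true  = distance2 v w (distance2ᵇ-sound d2 (≡false⇒≢true v~w))

  separated⇒IsL21 : ∀ f → (∀ v w → separation v w ≤ ∣ f v - f w ∣) → IsL21 G f
  separated⇒IsL21 f separated =
      (λ v w v~w → subst (_≤ ∣ f v - f w ∣) (separation-adjacent v~w) (separated v w))
    , (λ v w d → subst (_≤ ∣ f v - f w ∣) (separation-distance2 d) (separated v w))

  spanLabellingᵇ : ℕ → (Fin n → ℕ) → Bool
  spanLabellingᵇ k f =
    allᶠ (λ v → allᶠ (λ w → separation v w ≤ᵇ ∣ f v - f w ∣)) ∧ allᶠ (λ v → f v ≤ᵇ k)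

  spanLabellingᵇ-sound : ∀ k f → spanLabellingᵇ k f ≡ true → HasL21Span G k
  spanLabellingᵇ-sound k f h =
      f
    , separated⇒IsL21 f (λ v w → ≤ᵇ-sound (allᶠ-sound _ (allᶠ-sound _ (∧-conicalˡ _ _ h) v) w))
    , (λ v → ≤ᵇ-sound (allᶠ-sound _ (∧-conicalʳ _ _ h) v))

-- A constraint problem lists, for each vertex in placement order, the required gaps to the
-- vertices already placed, most recent first; labels already chosen are kept in that same order.
fits : List ℕ → ℕ → List ℕ → Bool
fits (d ∷ ds) c (x ∷ xs) = (d ≤ᵇ ∣ c - x ∣) ∧ fits ds c xs
fits _        _ _        = true

anyUpTo : ℕ → (ℕ → Bool) → Bool
anyUpTo zero    p = p 0
anyUpTo (suc k) p = p (suc k) ∨ anyUpTo k p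

anyUpTo-complete : ∀ k p c → c ≤ k → p c ≡ true → anyUpTo k p ≡ true
anyUpTo-complete zero    p .zero z≤n pc = pc
anyUpTo-complete (suc k) p c c≤1+k pc with m≤n⇒m<n∨m≡n c≤1+k
... | inj₁ c<1+k = ∨-trueʳ (p (suc k)) (anyUpTo-complete k p c (m<1+n⇒m≤n c<1+k) pc)
... | inj₂ refl  = ∨-trueˡ _ pc

solvable : ℕ → List (List ℕ) → List ℕ → Bool
solvableWith : ℕ → List ℕ → List (List ℕ) → List ℕ → ℕ → Bool
solvable k []              labels = true
solvable k (gaps ∷ rest)   labels = anyUpTo k (solvableWith k gaps rest labels)
solvableWith k gaps rest labels c = fits gaps c labels ∧ solvable k rest (c ∷ labels)

module _ {n : ℕ} (G : Graph n) where

  constraints : List (Fin n) → List (Fin n) → List (List ℕ)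
  constraints []       placed = []
  constraints (v ∷ vs) placed = map (separation G v) placed ∷ constraints vs (v ∷ placed)

  solvable-complete : ∀ k f → IsL21 G f → (∀ v → f v ≤ k) →
                      ∀ vs placed → solvable k (constraints vs placed) (map f placed) ≡ true
  solvable-complete k f L f≤k []       placed = refl
  solvable-complete k f L f≤k (v ∷ vs) placed =
    anyUpTo-complete k _ (f v) (f≤k v)
      (∧-true (fits-placed placed) (solvable-complete k f L f≤k vs (v ∷ placed)))
    where
    fits-placed : ∀ ws → fits (map (separation G v) ws) (f v) (map f ws) ≡ true
    fits-placed []       = refl
    fits-placed (w ∷ ws) = ∧-true (≤ᵇ-complete (IsL21⇒separated G f L v w)) (fits-placed ws)

  noSpan-byExhaustion : ∀ k vs → solvable k (constraints vs []) [] ≡ false → ¬ HasL21Span G k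
  noSpan-byExhaustion k vs unsolvable (f , L , f≤k) =
    ≡false⇒≢true unsolvable (solvable-complete k f L f≤k vs [])

HasL21Span-mono : ∀ {n} {G : Graph n} {j k} → j ≤ k → HasL21Span G j → HasL21Span G k
HasL21Span-mono j≤k (f , L , f≤j) = f , L , (λ v → ≤-trans (f≤j v) j≤k)

LambdaIs-intro : ∀ {n} {G : Graph n} {k} →
                 HasL21Span G (suc k) → ¬ HasL21Span G k → LambdaIs G (suc k)
LambdaIs-intro {G = G} span noSpan =
  span , λ { j (s≤s j≤k) spanʲ → noSpan (HasL21Span-mono {G = G} j≤k spanʲ) }

LambdaIs-unique : ∀ {n} {G : Graph n} {a b} → LambdaIs G a → LambdaIs G b → a ≡ b
LambdaIs-unique {a = a} {b} (spanᵃ , minᵃ) (spanᵇ , minᵇ) with <-cmp a b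
... | tri< a<b _ _ = ⊥-elim (minᵇ a a<b spanᵃ)
... | tri≈ _ a≡b _ = a≡b
... | tri> _ _ b<a = ⊥-elim (minᵃ b b<a spanᵇ)

record _↪_ {m n : ℕ} (G : Graph m) (H : Graph n) : Set where
  field
    to        : Fin m → Fin n
    injective : Injective _≡_ _≡_ to
    preserves : ∀ {a b} → a ~[ G ] b → to a ~[ H ] to b

HasL21Span-restrict : ∀ {m n} {G : Graph m} {H : Graph n} {k} →
                      G ↪ H → HasL21Span H k → HasL21Span G k
HasL21Span-restrict {G = G} {H} E (f , (adjacent , distance2) , f≤k) =
  f ∘ to , (adjacent′ , distance2′) , f≤k ∘ to
  where
  open _↪_ E
  adjacent′ : ∀ a b → a ~[ G ] b → 2 ≤ ∣ f (to a) - f (to b) ∣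
  adjacent′ a b a~b = adjacent _ _ (preserves a~b)
  -- A pair at distance 2 in G lands at distance 1 or 2 in H; either way the labels differ.
  distance2′ : ∀ a b → Dist2 G a b → 1 ≤ ∣ f (to a) - f (to b) ∣
  distance2′ a b (a≢b , _ , w , a~w , w~b) with adj H (to a) (to b) in ta~tb
  ... | true  = ≤-trans (s≤s z≤n) (adjacent _ _ ta~tb)
  ... | false =
    distance2 _ _ (a≢b ∘ injective , ≡false⇒≢true ta~tb , to w , preserves a~w , preserves w~b)

unkind : ∀ {n} → MKind n → Fin (n + n + 1)
unkind {n} (orig i)   = (i ↑ˡ n) ↑ˡ 1
unkind {n} (shadow i) = (n ↑ʳ i) ↑ˡ 1
unkind {n} hub        = (n + n) ↑ʳ zero

kind-unkind : ∀ {n} (a : MKind n) → kind (unkind a) ≡ a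
kind-unkind {n} (orig i)   rewrite splitAt-↑ˡ (n + n) (i ↑ˡ n) 1 | splitAt-↑ˡ n i n = refl
kind-unkind {n} (shadow i) rewrite splitAt-↑ˡ (n + n) (n ↑ʳ i) 1 | splitAt-↑ʳ n n i = refl
kind-unkind {n} hub        rewrite splitAt-↑ʳ (n + n) 1 zero = refl

join-split : ∀ m n {x : Fin (m + n)} {s} → splitAt m x ≡ s → join m n s ≡ x
join-split m n {x} split≡s = trans (cong (join m n) (≡-sym split≡s)) (join-splitAt m n x)

unkind-kind : ∀ {n} (x : Fin (n + n + 1)) → unkind (kind {n} x) ≡ x
unkind-kind {n} x with splitAt (n + n) x in outer
... | inj₂ zero = join-split (n + n) 1 outer
... | inj₁ y with splitAt n y in inner
...   | inj₁ i = trans (cong (_↑ˡ 1) (join-split n n inner)) (join-split (n + n) 1 outer)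
...   | inj₂ i = trans (cong (_↑ˡ 1) (join-split n n inner)) (join-split (n + n) 1 outer)

unkind-injective : ∀ {n} → Injective _≡_ _≡_ (unkind {n})
unkind-injective {n} {a} {b} e =
  trans (≡-sym (kind-unkind a)) (trans (cong (kind {n}) e) (kind-unkind b))

kind-injective : ∀ {n} → Injective _≡_ _≡_ (kind {n})
kind-injective {n} {x} {y} e =
  trans (≡-sym (unkind-kind {n} x)) (trans (cong unkind e) (unkind-kind {n} y))

underlying : ∀ {n} → Fin n → MKind n → Fin n
underlying _ (orig i)   = i
underlying _ (shadow i) = i
underlying d hub        = d

mapMKind : ∀ {m n} → (Fin m → Fin n) → MKind m → MKind n
mapMKind f (orig i)   = orig (f i)
mapMKind f (shadow i) = shadow (f i)
mapMKind f hub        = hub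

mapMKind-injective : ∀ {m n} {f : Fin m → Fin n} →
                     Injective _≡_ _≡_ f → Injective _≡_ _≡_ (mapMKind f)
mapMKind-injective {f = f} f-inj {orig i}   {orig j}   e = cong orig   (f-inj (cong (underlying (f i)) e))
mapMKind-injective {f = f} f-inj {shadow i} {shadow j} e = cong shadow (f-inj (cong (underlying (f i)) e))
mapMKind-injective         _     {hub}      {hub}      _ = refl

madj-map : ∀ {m n} {G : Graph m} {H : Graph n} (E : G ↪ H) a b →
           madj G a b ≡ true → madj H (mapMKind (_↪_.to E) a) (mapMKind (_↪_.to E) b) ≡ true
madj-map E (orig i)   (orig j)   i~j = _↪_.preserves E i~j
madj-map E (orig i)   (shadow j) i~j = _↪_.preserves E i~j
madj-map E (shadow i) (orig j)   i~j = _↪_.preserves E i~j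
madj-map E (shadow i) hub        _   = refl
madj-map E hub        (shadow j) _   = refl

M-↪ : ∀ {m n} {G : Graph m} {H : Graph n} → G ↪ H → M G ↪ M H
M-↪ {m} {n} {G} {H} E = record { to = to′ ; injective = injective′ ; preserves = preserves′ }
  where
  open _↪_ E
  to′ : Fin (m + m + 1) → Fin (n + n + 1)
  to′ = unkind ∘ mapMKind to ∘ kind {m}
  injective′ : Injective _≡_ _≡_ to′
  injective′ = kind-injective ∘ mapMKind-injective injective ∘ unkind-injective
  preserves′ : ∀ {x y} → x ~[ M G ] y → to′ x ~[ M H ] to′ y
  preserves′ {x} {y} x~y
    rewrite kind-unkind (mapMKind to (kind {m} x)) | kind-unkind (mapMKind to (kind {m} y)) =
    madj-map E (kind {m} x) (kind {m} y) x~y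

≅-sym : ∀ {m n} {G : Graph m} {H : Graph n} → G ≅ H → H ≅ G
≅-sym {G = G} {H} (φ , φ-adj) = ↔-sym φ , λ i j →
  trans (≡-sym (φ-adj (from i) (from j))) (cong₂ (adj H) (strictlyInverseˡ i) (strictlyInverseˡ j))
  where open Inverse φ

≅-trans : ∀ {a b c} {G : Graph a} {H : Graph b} {K : Graph c} → G ≅ H → H ≅ K → G ≅ K
≅-trans (φ , φ-adj) (ψ , ψ-adj) = ψ ↔-∘ φ , λ i j → trans (ψ-adj _ _) (φ-adj i j)

≅⇒↪ : ∀ {m n} {G : Graph m} {H : Graph n} → G ≅ H → G ↪ H
≅⇒↪ (φ , φ-adj) = record
  { to        = Inverse.to φ
  ; injective = Injection.injective (↔⇒↣ φ)
  ; preserves = λ {a} {b} a~b → trans (φ-adj a b) a~b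
  }

≅⇒↩ : ∀ {m n} {G : Graph m} {H : Graph n} → G ≅ H → H ↪ G
≅⇒↩ {G = G} {H} = ≅⇒↪ ∘ ≅-sym {G = G} {H}

Connected-≅ : ∀ {m n} {G : Graph m} {H : Graph n} → G ≅ H → Connected G → Connected H
Connected-≅ {G = G} {H} (φ , φ-adj) connected x y =
  subst₂ (Reach H) (strictlyInverseˡ x) (strictlyInverseˡ y)
    (transport (connected (from x) (from y)))
  where
  open Inverse φ
  transport : ∀ {i j} → Reach G i j → Reach H (to i) (to j)
  transport here                 = here
  transport (step {i} {j} i~j r) = step (trans (φ-adj i j) i~j) (transport r)

LambdaIs-↪↩ : ∀ {m n} {G : Graph m} {H : Graph n} {k} →
              G ↪ H → H ↪ G → LambdaIs H k → LambdaIs G k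
LambdaIs-↪↩ G↪H H↪G (span , minimal) =
  HasL21Span-restrict G↪H span , λ j j<k spanᴳ → minimal j j<k (HasL21Span-restrict H↪G spanᴳ)

LambdaIs-M-≅ : ∀ {m n} {G : Graph m} {H : Graph n} {k} → G ≅ H → LambdaIs (M H) k → LambdaIs (M G) k
LambdaIs-M-≅ {G = G} {H} G≅H = LambdaIs-↪↩ (M-↪ (≅⇒↪ G≅H)) (M-↪ (≅⇒↩ {G = G} {H} G≅H))

MLambda>7 : ∀ {n} → Graph n → Set
MLambda>7 G = ¬ HasL21Span (M G) 7

MLambda>7-↪ : ∀ {m n} {G : Graph m} {H : Graph n} → G ↪ H → MLambda>7 G → MLambda>7 H
MLambda>7-↪ G↪H large = large ∘ HasL21Span-restrict (M-↪ G↪H)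

starAdj : ∀ {m} → Fin (suc m) → Fin (suc m) → Bool
starAdj zero    zero    = false
starAdj zero    (suc _) = true
starAdj (suc _) zero    = true
starAdj (suc _) (suc _) = false

starAdj-sym : ∀ {m} (i j : Fin (suc m)) → starAdj i j ≡ starAdj j i
starAdj-sym zero    zero    = refl
starAdj-sym zero    (suc _) = refl
starAdj-sym (suc _) zero    = refl
starAdj-sym (suc _) (suc _) = refl

starAdj-irrefl : ∀ {m} (i : Fin (suc m)) → starAdj i i ≡ false
starAdj-irrefl zero    = refl
starAdj-irrefl (suc _) = refl

Star : (m : ℕ) → Graph (suc m)
Star m = record { adj = starAdj ; sym = starAdj-sym ; irrefl = starAdj-irrefl }

star-↪ : ∀ {m n} (G : Graph n) (c : Fin n) (leaf : Fin m → Fin n) → Injective _≡_ _≡_ leaf →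
         (∀ i → c ~[ G ] leaf i) → Star m ↪ G
star-↪ {m} {n} G c leaf leaf-injective c~leaf =
  record { to = embed ; injective = embed-injective ; preserves = embed-preserves }
  where
  embed : Fin (suc m) → Fin n
  embed zero    = c
  embed (suc i) = leaf i
  c≢leaf : ∀ i → c ≢ leaf i
  c≢leaf i c≡leaf =
    ≡false⇒≢true (irrefl G (leaf i)) (subst (λ z → z ~[ G ] leaf i) c≡leaf (c~leaf i))
  embed-injective : Injective _≡_ _≡_ embed
  embed-injective {zero}  {zero}  _ = refl
  embed-injective {zero}  {suc j} e = ⊥-elim (c≢leaf j e)
  embed-injective {suc i} {zero}  e = ⊥-elim (c≢leaf i (≡-sym e))
  embed-injective {suc i} {suc j} e = cong suc (leaf-injective e)
  embed-preserves : ∀ {a b} → a ~[ Star m ] b → embed a ~[ G ] embed b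
  embed-preserves {zero}  {suc j} _ = c~leaf j
  embed-preserves {suc i} {zero}  _ = trans (sym G (leaf i) c) (c~leaf i)

ThreeDistinct : ∀ {n} → (Fin n → Set) → Set
ThreeDistinct {n} P = Σ[ a ∈ Fin n ] Σ[ b ∈ Fin n ] Σ[ c ∈ Fin n ]
  (a ≢ b × a ≢ c × b ≢ c × P a × P b × P c)

ThreeDistinct-map : ∀ {m n} {P : Fin m → Set} {Q : Fin n → Set} (f : Fin m → Fin n) →
                    Injective _≡_ _≡_ f → (∀ {i} → P i → Q (f i)) →
                    ThreeDistinct P → ThreeDistinct Q
ThreeDistinct-map f f-injective P⇒Q (a , b , c , a≢b , a≢c , b≢c , Pa , Pb , Pc) =
    f a , f b , f c
  , a≢b ∘ f-injective , a≢c ∘ f-injective , b≢c ∘ f-injective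
  , P⇒Q Pa , P⇒Q Pb , P⇒Q Pc

MaxDegree≥3 : ∀ {n} → Graph n → Set
MaxDegree≥3 {n} G = Σ[ v ∈ Fin n ] ThreeDistinct (v ~[ G ]_)

star₃-↪ : ∀ {n} {G : Graph n} → MaxDegree≥3 G → Star 3 ↪ G
star₃-↪ {n} {G} (v , a , b , c , a≢b , a≢c , b≢c , v~a , v~b , v~c) =
  star-↪ G v leaf leaf-injective v~leaf
  where
  leaf : Fin 3 → Fin n
  leaf zero             = a
  leaf (suc zero)       = b
  leaf (suc (suc zero)) = c
  leaf-injective : Injective _≡_ _≡_ leaf
  leaf-injective {zero}             {zero}             _ = refl
  leaf-injective {zero}             {suc zero}         e = ⊥-elim (a≢b e)
  leaf-injective {zero}             {suc (suc zero)}   e = ⊥-elim (a≢c e)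
  leaf-injective {suc zero}         {zero}             e = ⊥-elim (a≢b (≡-sym e))
  leaf-injective {suc zero}         {suc zero}         _ = refl
  leaf-injective {suc zero}         {suc (suc zero)}   e = ⊥-elim (b≢c e)
  leaf-injective {suc (suc zero)}   {zero}             e = ⊥-elim (a≢c (≡-sym e))
  leaf-injective {suc (suc zero)}   {suc zero}         e = ⊥-elim (b≢c (≡-sym e))
  leaf-injective {suc (suc zero)}   {suc (suc zero)}   _ = refl
  v~leaf : ∀ i → v ~[ G ] leaf i
  v~leaf zero             = v~a
  v~leaf (suc zero)       = v~b
  v~leaf (suc (suc zero)) = v~c

-- Placing the hub and the shadows first, which are pairwise within distance 2, makes the
-- search fail early.
hubFirst : ∀ n → List (Fin (n + n + 1))
hubFirst n = unkind (hub {n}) ∷ map (unkind ∘ shadow) (allFin n) ++ map (unkind ∘ orig) (allFin n)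

MLambda>7-byExhaustion : ∀ {n} (G : Graph n) →
                         solvable 7 (constraints (M G) (hubFirst n) []) [] ≡ false → MLambda>7 G
MLambda>7-byExhaustion {n} G = noSpan-byExhaustion (M G) 7 (hubFirst n)

LambdaIs-M-byComputation : ∀ {n} (G : Graph n) k (f : Vec ℕ (n + n + 1)) →
  spanLabellingᵇ (M G) (suc k) (lookup f) ≡ true →
  solvable k (constraints (M G) (hubFirst n) []) [] ≡ false →
  LambdaIs (M G) (suc k)
LambdaIs-M-byComputation {n} G k f labelling unsolvable =
  LambdaIs-intro {G = M G} (spanLabellingᵇ-sound (M G) (suc k) (lookup f) labelling)
    (noSpan-byExhaustion (M G) k (hubFirst n) unsolvable)

MLambda>7-K₁₃ : MLambda>7 (Star 3)
MLambda>7-K₁₃ = MLambda>7-byExhaustion (Star 3) refl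

K₁₇-noSpan7 : ¬ HasL21Span (Star 7) 7
K₁₇-noSpan7 = noSpan-byExhaustion (Star 7) 7 (allFin 8) refl

MLambda>7-degree≥3 : ∀ {n} {G : Graph n} → MaxDegree≥3 G → MLambda>7 G
MLambda>7-degree≥3 deg = MLambda>7-↪ (star₃-↪ deg) MLambda>7-K₁₃

MLambda>7-order≥7 : ∀ {n} (G : Graph n) → 7 ≤ n → MLambda>7 G
MLambda>7-order≥7 {n} G 7≤n =
  K₁₇-noSpan7 ∘ HasL21Span-restrict (star-↪ (M G) (unkind (hub {n})) leaf leaf-injective hub~leaf)
  where
  leaf : Fin 7 → Fin (n + n + 1)
  leaf i = unkind (shadow (inject≤ i 7≤n))
  leaf-injective : Injective _≡_ _≡_ leaf
  leaf-injective {i} {j} e = inject≤-injective 7≤n 7≤n i j (cong (underlying (inject≤ i 7≤n))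
    (unkind-injective {n} {shadow (inject≤ i 7≤n)} {shadow (inject≤ j 7≤n)} e))
  hub~leaf : ∀ i → unkind (hub {n}) ~[ M G ] leaf i
  hub~leaf i rewrite kind-unkind {n} hub | kind-unkind (shadow (inject≤ i 7≤n)) = refl

MaxDegree≥3-↪ : ∀ {m n} {G : Graph m} {H : Graph n} → G ↪ H → MaxDegree≥3 G → MaxDegree≥3 H
MaxDegree≥3-↪ E (v , neighbours) = to v , ThreeDistinct-map to injective preserves neighbours
  where open _↪_ E

-- Upper-triangular adjacency matrices: the first row lists the neighbours of vertex 0 among
-- the vertices 1, …, n-1.
Code : ℕ → Set
Code zero    = ⊤
Code (suc n) = Vec Bool n × Code n

codeAdj : ∀ {n} → Code n → Fin n → Fin n → Bool
codeAdj {suc n} (r , t) zero    zero    = false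
codeAdj {suc n} (r , t) zero    (suc j) = lookup r j
codeAdj {suc n} (r , t) (suc i) zero    = lookup r i
codeAdj {suc n} (r , t) (suc i) (suc j) = codeAdj t i j

codeAdj-sym : ∀ {n} (t : Code n) i j → codeAdj t i j ≡ codeAdj t j i
codeAdj-sym {suc n} (r , t) zero    zero    = refl
codeAdj-sym {suc n} (r , t) zero    (suc j) = refl
codeAdj-sym {suc n} (r , t) (suc i) zero    = refl
codeAdj-sym {suc n} (r , t) (suc i) (suc j) = codeAdj-sym t i j

codeAdj-irrefl : ∀ {n} (t : Code n) i → codeAdj t i i ≡ false
codeAdj-irrefl {suc n} (r , t) zero    = refl
codeAdj-irrefl {suc n} (r , t) (suc i) = codeAdj-irrefl t i

decode : ∀ {n} → Code n → Graph n
decode t = record { adj = codeAdj t ; sym = codeAdj-sym t ; irrefl = codeAdj-irrefl t }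

encode : ∀ {n} → (Fin n → Fin n → Bool) → Code n
encode {zero}  a = tt
encode {suc n} a = tabulate (a zero ∘ suc) , encode (λ i j → a (suc i) (suc j))

codeAdj-encode : ∀ {n} (G : Graph n) i j → codeAdj (encode (adj G)) i j ≡ adj G i j
codeAdj-encode {suc n} G zero    zero    = ≡-sym (irrefl G zero)
codeAdj-encode {suc n} G zero    (suc j) = lookup∘tabulate _ j
codeAdj-encode {suc n} G (suc i) zero    = trans (lookup∘tabulate _ i) (sym G zero (suc i))
codeAdj-encode {suc n} G (suc i) (suc j) = codeAdj-encode tail i j
  where
  tail : Graph n
  tail = record
    { adj    = λ i j → adj G (suc i) (suc j)
    ; sym    = λ i j → sym G (suc i) (suc j)
    ; irrefl = irrefl G ∘ suc
    }

≅-decode-encode : ∀ {n} (G : Graph n) → G ≅ decode (encode (adj G))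
≅-decode-encode G = ↔-id _ , codeAdj-encode G

atLeast1 atLeast2 atLeast3 : ∀ {m} → Vec Bool m → Bool
atLeast1 []      = false
atLeast1 (b ∷ r) = b ∨ atLeast1 r
atLeast2 []      = false
atLeast2 (b ∷ r) = (b ∧ atLeast1 r) ∨ atLeast2 r
atLeast3 []      = false
atLeast3 (b ∷ r) = (b ∧ atLeast2 r) ∨ atLeast3 r

TwoDistinct : ∀ {n} → (Fin n → Set) → Set
TwoDistinct {n} P = Σ[ a ∈ Fin n ] Σ[ b ∈ Fin n ] (a ≢ b × P a × P b)

atLeast1-sound : ∀ {m} (r : Vec Bool m) → atLeast1 r ≡ true → Σ[ i ∈ Fin m ] lookup r i ≡ true
atLeast1-sound (b ∷ r) h with ∨-true {b} h
... | inj₁ b≡true = zero , b≡true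
... | inj₂ rest with atLeast1-sound r rest
...   | i , ri = suc i , ri

atLeast2-sound : ∀ {m} (r : Vec Bool m) → atLeast2 r ≡ true → TwoDistinct (λ i → lookup r i ≡ true)
atLeast2-sound (b ∷ r) h with ∨-true {b ∧ atLeast1 r} h
... | inj₁ headAnd with atLeast1-sound r (∧-conicalʳ b _ headAnd)
...   | i , ri = zero , suc i , (λ ()) , ∧-conicalˡ _ _ headAnd , ri
atLeast2-sound (b ∷ r) h | inj₂ rest with atLeast2-sound r rest
...   | i , j , i≢j , ri , rj = suc i , suc j , i≢j ∘ suc-injective , ri , rj

atLeast3-sound : ∀ {m} (r : Vec Bool m) → atLeast3 r ≡ true → ThreeDistinct (λ i → lookup r i ≡ true)
atLeast3-sound (b ∷ r) h with ∨-true {b ∧ atLeast2 r} h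
... | inj₁ headAnd with atLeast2-sound r (∧-conicalʳ b _ headAnd)
...   | i , j , i≢j , ri , rj =
  zero , suc i , suc j , (λ ()) , (λ ()) , i≢j ∘ suc-injective , ∧-conicalˡ _ _ headAnd , ri , rj
atLeast3-sound (b ∷ r) h | inj₂ rest = ThreeDistinct-map suc suc-injective id (atLeast3-sound r rest)

allVec : ∀ {n} → (Vec Bool n → Bool) → Bool
allVec {zero}  p = p []
allVec {suc n} p = allVec (λ v → p (true ∷ v)) ∧ allVec (λ v → p (false ∷ v))

allVec-sound : ∀ {n} (p : Vec Bool n → Bool) → allVec p ≡ true → ∀ v → p v ≡ true
allVec-sound {zero}  p h []          = h
allVec-sound {suc n} p h (true ∷ v)  = allVec-sound (λ v → p (true ∷ v)) (∧-conicalˡ _ _ h) v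
allVec-sound {suc n} p h (false ∷ v) =
  allVec-sound (λ v → p (false ∷ v)) (∧-conicalʳ (allVec (λ v → p (true ∷ v))) _ h) v

-- Skips every code one of whose rows has three true entries, together with all its extensions.
allCodes : ∀ {n} → (Code n → Bool) → Bool
allCodes {zero}  p = p tt
allCodes {suc n} p = allVec (λ r → atLeast3 r ∨ allCodes (λ t → p (r , t)))

allCodes-sound : ∀ {n} (p : Code n → Bool) → allCodes p ≡ true →
                 ∀ t → MaxDegree≥3 (decode t) ⊎ p t ≡ true
allCodes-sound {zero}  p h tt = inj₂ h
allCodes-sound {suc n} p h (r , t) with ∨-true {atLeast3 r} (allVec-sound _ h r)
... | inj₁ three = inj₁ (zero , ThreeDistinct-map suc suc-injective id (atLeast3-sound r three))
... | inj₂ rest with allCodes-sound (λ t → p (r , t)) rest t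
...   | inj₁ (v , neighbours) = inj₁ (suc v , ThreeDistinct-map suc suc-injective id neighbours)
...   | inj₂ pt               = inj₂ pt

firstᶠ : ∀ {n} → (Fin n → Bool) → Maybe (Fin n)
firstᶠ {zero}  p = nothing
firstᶠ {suc n} p = if p zero then just zero else Maybe.map suc (firstᶠ (p ∘ suc))

positionIn : ∀ {n m} → Vec (Fin n) m → Fin n → Maybe (Fin m)
positionIn []       x = nothing
positionIn (y ∷ ys) x = if ⌊ y Fin.≟ x ⌋ then just zero else Maybe.map suc (positionIn ys x)

module Recognise {n : ℕ} (G : Graph n) where

  row : Fin n → Vec Bool n
  row v = tabulate (adj G v)

  degree≥3ᵇ : Bool
  degree≥3ᵇ = anyᶠ (λ v → atLeast3 (row v))

  degree≥3ᵇ-sound : degree≥3ᵇ ≡ true → MaxDegree≥3 G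
  degree≥3ᵇ-sound h with anyᶠ-sound _ h
  ... | v , three = v , ThreeDistinct-map id id (λ {i} → trans (≡-sym (lookup∘tabulate (adj G v) i)))
                                               (atLeast3-sound (row v) three)

  closedᵇ : Vec Bool n → Bool
  closedᵇ S = allᶠ (λ x → allᶠ (λ y → not (lookup S x ∧ adj G x y) ∨ lookup S y))

  Reach-closed : ∀ S → closedᵇ S ≡ true →
                 ∀ {i j} → Reach G i j → lookup S i ≡ true → lookup S j ≡ true
  Reach-closed S closed here                Si = Si
  Reach-closed S closed (step {i} {j} i~j r) Si =
    Reach-closed S closed r (edge (allᶠ-sound _ (allᶠ-sound _ closed i) j))
    where
    edge : not (lookup S i ∧ adj G i j) ∨ lookup S j ≡ true → lookup S j ≡ true
    edge e rewrite Si | i~j = e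

  grow : Vec Bool n → Vec Bool n
  grow S = tabulate (λ x → lookup S x ∨ anyᶠ (λ y → lookup S y ∧ adj G y x))

  growⁿ : ℕ → Vec Bool n → Vec Bool n
  growⁿ zero    S = S
  growⁿ (suc k) S = growⁿ k (grow S)

  separatesᵇ : Fin n → Vec Bool n → Bool
  separatesᵇ s S = lookup S s ∧ anyᶠ (λ j → not (lookup S j)) ∧ closedᵇ S

  separatesᵇ-sound : ∀ s S → separatesᵇ s S ≡ true → ¬ Connected G
  separatesᵇ-sound s S h connected with anyᶠ-sound _ (∧-conicalˡ _ _ (∧-conicalʳ (lookup S s) _ h))
  ... | j , S∌j = ≡false⇒≢true (not-≡true S∌j)
    (Reach-closed S (∧-conicalʳ _ _ (∧-conicalʳ (lookup S s) _ h)) (connected s j) (∧-conicalˡ _ _ h))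

  -- Only the closedness of the final set is checked, so the growth needs no correctness proof.
  reachedFrom : Fin n → Vec Bool n
  reachedFrom s = growⁿ n (tabulate (λ x → ⌊ x Fin.≟ s ⌋))

  disconnectedᵇ : Fin n → Bool
  disconnectedᵇ s = separatesᵇ s (reachedFrom s)

  disconnectedᵇ-sound : ∀ s → disconnectedᵇ s ≡ true → ¬ Connected G
  disconnectedᵇ-sound s = separatesᵇ-sound s (reachedFrom s)

  isIsoᵇ : ∀ {m} (T : Graph m) → (Fin m → Fin n) → (Fin n → Fin m) → Bool
  isIsoᵇ T π σ = allᶠ (λ p → ⌊ σ (π p) Fin.≟ p ⌋)
               ∧ allᶠ (λ x → ⌊ π (σ x) Fin.≟ x ⌋)
               ∧ allᶠ (λ i → allᶠ (λ j → ⌊ adj T (σ i) (σ j) Bool.≟ adj G i j ⌋))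

  isIsoᵇ-sound : ∀ {m} (T : Graph m) π σ → isIsoᵇ T π σ ≡ true → G ≅ T
  isIsoᵇ-sound T π σ h =
      mk↔ₛ′ σ π (λ p → isYes-sound (σ (π p) Fin.≟ p) (allᶠ-sound _ σπ p))
                (λ x → isYes-sound (π (σ x) Fin.≟ x) (allᶠ-sound _ πσ x))
    , λ i j → isYes-sound (adj T (σ i) (σ j) Bool.≟ adj G i j) (allᶠ-sound _ (allᶠ-sound _ adjacency i) j)
    where
    σπ        = ∧-conicalˡ _ _ h
    rest      = ∧-conicalʳ (allᶠ (λ p → ⌊ σ (π p) Fin.≟ p ⌋)) _ h
    πσ        = ∧-conicalˡ _ _ rest
    adjacency = ∧-conicalʳ (allᶠ (λ x → ⌊ π (σ x) Fin.≟ x ⌋)) _ rest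

  isIsoAlongᵇ : (T : Graph n) → Vec (Fin n) n → Bool
  isIsoAlongᵇ T vs = isIsoᵇ T (lookup vs) (λ x → fromMaybe x (positionIn vs x))

  isIsoAlongᵇ-sound : (T : Graph n) (vs : Vec (Fin n) n) → isIsoAlongᵇ T vs ≡ true → G ≅ T
  isIsoAlongᵇ-sound T vs = isIsoᵇ-sound T _ _

  nextFrom : Maybe (Fin n) → Fin n → Fin n
  nextFrom previous v = fromMaybe v (firstᶠ (λ w → adj G v w ∧ differs previous w))
    where
    differs : Maybe (Fin n) → Fin n → Bool
    differs nothing  _ = true
    differs (just p) w = not ⌊ p Fin.≟ w ⌋

  -- Keeps stepping to a neighbour other than the previous vertex; from an end of a path, or from
  -- any vertex of a cycle, this lists every vertex once. Soundness rests on the final isomorphism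
  -- check alone.
  walk : (m : ℕ) → Maybe (Fin n) → Fin n → Vec (Fin n) m
  walk zero    previous v = []
  walk (suc m) previous v = v ∷ walk m (just v) (nextFrom previous v)

  pathᵇ : Bool
  pathᵇ with firstᶠ (λ v → not (atLeast2 (row v)))
  ... | nothing  = false
  ... | just end = isIsoAlongᵇ (Path n) (walk n nothing end)

  pathᵇ-sound : pathᵇ ≡ true → G ≅ Path n
  pathᵇ-sound h with firstᶠ (λ v → not (atLeast2 (row v)))
  ... | just end = isIsoAlongᵇ-sound (Path n) (walk n nothing end) h

IsCycle : (n : ℕ) → Graph n → Set
IsCycle (suc (suc (suc k))) G = G ≅ Cycle k
IsCycle _                   G = ⊥

cycleᵇ : ∀ {n} → Graph n → Bool
cycleᵇ {suc (suc (suc k))} G = Recognise.isIsoAlongᵇ G (Cycle k) (Recognise.walk G _ nothing zero)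
cycleᵇ {_}                 G = false

cycleᵇ-sound : ∀ {n} (G : Graph n) → cycleᵇ G ≡ true → IsCycle n G
cycleᵇ-sound {suc (suc (suc k))} G =
  Recognise.isIsoAlongᵇ-sound G (Cycle k) (Recognise.walk G _ nothing zero)

SmallCase : ∀ {n} → Graph n → Set
SmallCase {n} G = MaxDegree≥3 G ⊎ ¬ Connected G ⊎ G ≅ Path n ⊎ IsCycle n G

classifyᵇ : ∀ {n} → Graph n → Bool
classifyᵇ {zero}  G = true
classifyᵇ {suc n} G = degree≥3ᵇ ∨ disconnectedᵇ zero ∨ pathᵇ ∨ cycleᵇ G
  where open Recognise G

classifyᵇ-sound : ∀ {n} (G : Graph n) → classifyᵇ G ≡ true → SmallCase G
classifyᵇ-sound {zero}  G _ = inj₂ (inj₂ (inj₁ (↔-id _ , λ ())))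
classifyᵇ-sound {suc n} G h with ∨-true {Recognise.degree≥3ᵇ G} h
... | inj₁ deg = inj₁ (Recognise.degree≥3ᵇ-sound G deg)
... | inj₂ h₁ with ∨-true {Recognise.disconnectedᵇ G zero} h₁
...   | inj₁ disconnected = inj₂ (inj₁ (Recognise.disconnectedᵇ-sound G zero disconnected))
...   | inj₂ h₂ with ∨-true {Recognise.pathᵇ G} h₂
...     | inj₁ path  = inj₂ (inj₂ (inj₁ (Recognise.pathᵇ-sound G path)))
...     | inj₂ cycle = inj₂ (inj₂ (inj₂ (cycleᵇ-sound G cycle)))

IsCycle-≅ : ∀ {n} {G H : Graph n} → G ≅ H → IsCycle n H → IsCycle n G
IsCycle-≅ {suc (suc (suc k))} {G} {H} G≅H H≅C = ≅-trans {G = G} {H} {Cycle k} G≅H H≅C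

SmallCase-≅ : ∀ {n} {G H : Graph n} → G ≅ H → SmallCase H → SmallCase G
SmallCase-≅ {G = G} {H} G≅H (inj₁ deg)                 = inj₁ (MaxDegree≥3-↪ {G = H} {G} (≅⇒↩ G≅H) deg)
SmallCase-≅ {G = G} {H} G≅H (inj₂ (inj₁ disconnected)) = inj₂ (inj₁ (disconnected ∘ Connected-≅ {G = G} G≅H))
SmallCase-≅ {n} {G} {H} G≅H (inj₂ (inj₂ (inj₁ path)))  = inj₂ (inj₂ (inj₁ (≅-trans {G = G} {H} {Path n} G≅H path)))
SmallCase-≅             G≅H (inj₂ (inj₂ (inj₂ cycle))) = inj₂ (inj₂ (inj₂ (IsCycle-≅ G≅H cycle)))

allCodes-classifyᵇ : ∀ {n} → n ≤ 6 → allCodes {n} (classifyᵇ ∘ decode) ≡ true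
allCodes-classifyᵇ {0} _ = refl
allCodes-classifyᵇ {1} _ = refl
allCodes-classifyᵇ {2} _ = refl
allCodes-classifyᵇ {3} _ = refl
allCodes-classifyᵇ {4} _ = refl
allCodes-classifyᵇ {5} _ = refl
allCodes-classifyᵇ {6} _ = refl
allCodes-classifyᵇ {suc (suc (suc (suc (suc (suc (suc _))))))} (s≤s (s≤s (s≤s (s≤s (s≤s (s≤s ()))))))

smallCase : ∀ {n} → n ≤ 6 → (G : Graph n) → SmallCase G
smallCase n≤6 G with allCodes-sound _ (allCodes-classifyᵇ n≤6) (encode (adj G))
... | inj₁ deg        = inj₁ (MaxDegree≥3-↪ {G = decode (encode (adj G))} (≅⇒↩ {G = G} (≅-decode-encode G)) deg)
... | inj₂ classified = SmallCase-≅ (≅-decode-encode G) (classifyᵇ-sound _ classified)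

-- Labellings list the labels of v₁ … vₙ, v₁′ … vₙ′, u in this order.
lambda-M-P₀ : LambdaIs (M (Path 0)) 0
lambda-M-P₀ = spanLabellingᵇ-sound (M (Path 0)) 0 (λ _ → 0) refl , λ _ ()

lambda-M-P₁ : LambdaIs (M (Path 1)) 2
lambda-M-P₁ = LambdaIs-M-byComputation (Path 1) 1 (0 ∷ 2 ∷ 0 ∷ []) refl refl

lambda-M-K₂ : LambdaIs (M K₂) 4
lambda-M-K₂ = LambdaIs-M-byComputation K₂ 3 (1 ∷ 4 ∷ 2 ∷ 3 ∷ 0 ∷ []) refl refl

lambda-M-P₃ : LambdaIs (M P₃) 6
lambda-M-P₃ = LambdaIs-M-byComputation P₃ 5 (1 ∷ 6 ∷ 2 ∷ 3 ∷ 5 ∷ 4 ∷ 0 ∷ []) refl refl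

lambda-M-P₄ : LambdaIs (M P₄) 6
lambda-M-P₄ = LambdaIs-M-byComputation P₄ 5 (3 ∷ 6 ∷ 1 ∷ 4 ∷ 4 ∷ 5 ∷ 2 ∷ 3 ∷ 0 ∷ []) refl refl

lambda-M-C₃ : LambdaIs (M C₃) 6
lambda-M-C₃ = LambdaIs-M-byComputation C₃ 5 (0 ∷ 2 ∷ 6 ∷ 4 ∷ 3 ∷ 5 ∷ 1 ∷ []) refl refl

lambda-M-P₅ : LambdaIs (M P₅) 7
lambda-M-P₅ = LambdaIs-M-byComputation P₅ 6 (1 ∷ 3 ∷ 6 ∷ 1 ∷ 4 ∷ 5 ∷ 4 ∷ 7 ∷ 2 ∷ 3 ∷ 0 ∷ []) refl refl

lambda-M-P₆ : LambdaIs (M P₆) 7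
lambda-M-P₆ = LambdaIs-M-byComputation P₆ 6 (1 ∷ 3 ∷ 6 ∷ 1 ∷ 4 ∷ 7 ∷ 5 ∷ 4 ∷ 7 ∷ 2 ∷ 3 ∷ 6 ∷ 0 ∷ []) refl refl

lambda-M-C₆ : LambdaIs (M C₆) 7
lambda-M-C₆ = LambdaIs-M-byComputation C₆ 6 (1 ∷ 3 ∷ 6 ∷ 1 ∷ 4 ∷ 7 ∷ 5 ∷ 4 ∷ 7 ∷ 2 ∷ 3 ∷ 6 ∷ 0 ∷ []) refl refl

MLambda>7-C₄ : MLambda>7 (Cycle 1)
MLambda>7-C₄ = MLambda>7-byExhaustion (Cycle 1) refl

MLambda>7-C₅ : MLambda>7 (Cycle 2)
MLambda>7-C₅ = MLambda>7-byExhaustion (Cycle 2) refl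

-- The empty graph Path 0 is vacuously connected, hence the first clause.
MLambdaFamily : ∀ {n} → ℕ → Graph n → Set
MLambdaFamily 0 G = G ≅ Path 0
MLambdaFamily 2 G = G ≅ Path 1
MLambdaFamily 4 G = G ≅ K₂
MLambdaFamily 6 G = G ≅ P₃ ⊎ G ≅ P₄ ⊎ G ≅ C₃
MLambdaFamily 7 G = G ≅ P₅ ⊎ G ≅ P₆ ⊎ G ≅ C₆
MLambdaFamily _ G = ⊥

MLambdaFamily⇒LambdaIs : ∀ {n} {G : Graph n} k → MLambdaFamily k G → LambdaIs (M G) k
MLambdaFamily⇒LambdaIs {G = G} 0 G≅P               = LambdaIs-M-≅ {G = G} {Path 0} G≅P lambda-M-P₀
MLambdaFamily⇒LambdaIs {G = G} 2 G≅P               = LambdaIs-M-≅ {G = G} {Path 1} G≅P lambda-M-P₁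
MLambdaFamily⇒LambdaIs {G = G} 4 G≅K               = LambdaIs-M-≅ {G = G} {K₂} G≅K lambda-M-K₂
MLambdaFamily⇒LambdaIs {G = G} 6 (inj₁ G≅P)        = LambdaIs-M-≅ {G = G} {P₃} G≅P lambda-M-P₃
MLambdaFamily⇒LambdaIs {G = G} 6 (inj₂ (inj₁ G≅P)) = LambdaIs-M-≅ {G = G} {P₄} G≅P lambda-M-P₄
MLambdaFamily⇒LambdaIs {G = G} 6 (inj₂ (inj₂ G≅C)) = LambdaIs-M-≅ {G = G} {C₃} G≅C lambda-M-C₃
MLambdaFamily⇒LambdaIs {G = G} 7 (inj₁ G≅P)        = LambdaIs-M-≅ {G = G} {P₅} G≅P lambda-M-P₅
MLambdaFamily⇒LambdaIs {G = G} 7 (inj₂ (inj₁ G≅P)) = LambdaIs-M-≅ {G = G} {P₆} G≅P lambda-M-P₆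
MLambdaFamily⇒LambdaIs {G = G} 7 (inj₂ (inj₂ G≅C)) = LambdaIs-M-≅ {G = G} {C₆} G≅C lambda-M-C₆

Classified : ∀ {n} → Graph n → Set
Classified G = MLambda>7 G ⊎ Σ[ k ∈ ℕ ] MLambdaFamily k G

pathClassified : ∀ {m} {G : Graph m} n → n ≤ 6 → G ≅ Path n → Classified G
pathClassified 0 _ G≅P = inj₂ (0 , G≅P)
pathClassified 1 _ G≅P = inj₂ (2 , G≅P)
pathClassified 2 _ G≅P = inj₂ (4 , G≅P)
pathClassified 3 _ G≅P = inj₂ (6 , inj₁ G≅P)
pathClassified 4 _ G≅P = inj₂ (6 , inj₂ (inj₁ G≅P))
pathClassified 5 _ G≅P = inj₂ (7 , inj₁ G≅P)
pathClassified 6 _ G≅P = inj₂ (7 , inj₂ (inj₁ G≅P))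
pathClassified (suc (suc (suc (suc (suc (suc (suc _))))))) (s≤s (s≤s (s≤s (s≤s (s≤s (s≤s ())))))) _

cycleClassified : ∀ {n} {G : Graph n} → n ≤ 6 → IsCycle n G → Classified G
cycleClassified {3} _ G≅C = inj₂ (6 , inj₂ (inj₂ G≅C))
cycleClassified {4} _ G≅C = inj₁ (MLambda>7-↪ (≅⇒↩ G≅C) MLambda>7-C₄)
cycleClassified {5} _ G≅C = inj₁ (MLambda>7-↪ (≅⇒↩ G≅C) MLambda>7-C₅)
cycleClassified {6} _ G≅C = inj₂ (7 , inj₂ (inj₂ G≅C))
cycleClassified {suc (suc (suc (suc (suc (suc (suc _))))))} (s≤s (s≤s (s≤s (s≤s (s≤s (s≤s ())))))) _

classification : ∀ {n} (G : Graph n) → Connected G → Classified G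
classification {n} G connected with n ≤? 6
... | no n≰6 = inj₁ (MLambda>7-order≥7 G (≰⇒> n≰6))
... | yes n≤6 with smallCase n≤6 G
...   | inj₁ deg                  = inj₁ (MLambda>7-degree≥3 deg)
...   | inj₂ (inj₁ disconnected)  = ⊥-elim (disconnected connected)
...   | inj₂ (inj₂ (inj₁ path))   = pathClassified n n≤6 path
...   | inj₂ (inj₂ (inj₂ cycle))  = cycleClassified n≤6 cycle

LambdaIs⇒MLambdaFamily : ∀ {n} (G : Graph n) {k} →
                         Connected G → k ≤ 7 → LambdaIs (M G) k → MLambdaFamily k G
LambdaIs⇒MLambdaFamily G connected k≤7 lambda with classification G connected
... | inj₁ large        = ⊥-elim (large (HasL21Span-mono {G = M G} k≤7 (proj₁ lambda)))
... | inj₂ (j , family) =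
  subst (λ i → MLambdaFamily i G)
        (LambdaIs-unique {G = M G} (MLambdaFamily⇒LambdaIs j family) lambda) family

corollary3p6 : (n : ℕ) (G : Graph n) → Connected G →
      (LambdaIs (M G) 4 ⇔ G ≅ K₂)
    × (LambdaIs (M G) 6 ⇔ (G ≅ P₃ ⊎ G ≅ P₄ ⊎ G ≅ C₃))
    × (LambdaIs (M G) 7 ⇔ (G ≅ P₅ ⊎ G ≅ P₆ ⊎ G ≅ C₆))
corollary3p6 n G connected =
    mk⇔ (LambdaIs⇒MLambdaFamily G connected (≤ᵇ-sound refl)) (MLambdaFamily⇒LambdaIs 4)
  , mk⇔ (LambdaIs⇒MLambdaFamily G connected (≤ᵇ-sound refl)) (MLambdaFamily⇒LambdaIs 6)
  , mk⇔ (LambdaIs⇒MLambdaFamily G connected (≤ᵇ-sound refl)) (MLambdaFamily⇒LambdaIs 7)
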